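{- Let $H$ be a connected $k$-uniform hypergraph with $n$ vertices and multiple distinct edges. Then $Q_n=P_n=\left(\frac{k-1}{k},1\right)$; for each $m\in\{0,1,\ldots,k-2\}$ the interval $\left(\frac{m}{k},\frac{m+1}{k}\right]$ is exactly equal to some interval $Q_r$ of the lazy burning distribution and to some interval $P_s$ of the burning distribution (with $r,s<n$); and every nonempty interval of the lazy burning distribution or of the burning distribution other than $Q_n$ and $P_n$ is of the form $\left(\frac{m}{k},\frac{m+1}{k}\right]$ for some $m\in\{0,1,\ldots,k-2\}$.
   Context: A hypergraph $H=(V(H),E(H))$ has a finite nonempty vertex set and a finite collection $E(H)$ of subsets of $V(H)$ called edges; it is $k$-uniform if every edge has exactly $k$ vertices, and connected if any two vertices are joined by a path of vertices consecutive ones of which lie in a common edge. For a proportion $p\in(0,1)$, the proportion-based propagation rule is: if at the end of a round at least $\lceil p|e|\rceil$ vertices of an edge $e$ are on fire, then in the next round all vertices of $e$ catch fire; burned vertices stay burned. Burning game: let $F_0=\emptyset$ and $F_r$ be the set of burned vertices at the end of round $r$. In each round $r\geq 1$, simultaneously, vertices catch fire by propagation from $F_{r-1}$ (no propagation in round 1), and a player chooses a vertex $u_r\notin F_{r-1}$ (a source) and sets it on fire. A burning sequence is a sequence $(u_1,\ldots,u_k)$ of such sources after which every vertex is on fire at the end of round $k$; $b_p(H)$ is the minimum length of a burning sequence. Lazy game: $S\subseteq V(H)$ is a lazy burning set if, setting all of $S$ on fire at once and then repeatedly applying the propagation rule, every vertex eventually catches fire; $b_{L,p}(H)$ is the minimum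 size of a lazy burning set. The burning distribution is the partition of $(0,1)$ into the sets $P_j=\{p\in(0,1): b_p(H)=j\}$, and the lazy burning distribution into $Q_j=\{p\in(0,1): b_{L,p}(H)=j\}$, $j=1,\ldots,n$.
   Formalization: The proportion p takes only rational values in (0,1), in both the burning and the lazy burning distribution. -}

module Defs where

open import Data.Nat as ℕ using (ℕ; zero; suc; NonZero)
open import Data.Integer as ℤ using (ℤ; +_)
open import Data.Rational as ℚ using (ℚ; _/_; 0ℚ; 1ℚ; ceiling)
open import Data.Fin using (Fin)
open import Data.Fin.Subset using (Subset; _∈_; _∉_; _∩_; _∪_; ⁅_⁆; ∣_∣; ⊥)
open import Data.List using (List; []; _∷_; foldr; length)
open import Data.List.Membership.Propositional using () renaming (_∈_ to _∈ₗ_)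
open import Data.List.Relation.Unary.All using (All)
open import Data.Product using (Σ; ∃; _×_)
open import Data.Bool using (if_then_else_)
open import Relation.Nullary using (¬_)
open import Relation.Nullary.Decidable using (⌊_⌋)
open import Relation.Binary.PropositionalEquality using (_≡_; _≢_)
open import Relation.Binary.Construct.Closure.ReflexiveTransitive using (Star)
open import Data.Unit using (⊤)

-- A hypergraph on the vertex set Fin n, with a finite collection
-- (list, repetitions allowed) of edges, each edge a subset of Fin n.
record Hypergraph : Set where
  field
    n     : ℕ
    edges : List (Subset n)
open Hypergraph public

Uniform : ℕ → Hypergraph → Set
Uniform k H = All (λ e → ∣ e ∣ ≡ k) (edges H)

Adjacent : (H : Hypergraph) → Fin (n H) → Fin (n H) → Set
Adjacent H u v = ∃ λ e → e ∈ₗ edges H × u ∈ e × v ∈ e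

Connected : Hypergraph → Set
Connected H = ∀ u v → Star (Adjacent H) u v

MultipleDistinctEdges : Hypergraph → Set
MultipleDistinctEdges H =
  Σ (Subset (n H)) λ e₁ → Σ (Subset (n H)) λ e₂ →
    e₁ ∈ₗ edges H × e₂ ∈ₗ edges H × e₁ ≢ e₂

threshold : ∀ {m} → ℚ → Subset m → ℤ
threshold p e = ceiling (p ℚ.* (+ ∣ e ∣ / 1))

spread : (H : Hypergraph) → ℚ → Subset (n H) → Subset (n H)
spread H p F =
  foldr (λ e acc → if ⌊ threshold p e ℤ.≤? + ∣ e ∩ F ∣ ⌋ then e ∪ acc else acc)
        F (edges H)

AllBurned : ∀ {m} → Subset m → Set
AllBurned F = ∀ v → v ∈ F

-- Round 1 has no
-- propagation: F_1 = {u_1} (and u_1 ∉ F_0 = ∅ holds trivially).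

ValidFrom : (H : Hypergraph) → ℚ → Subset (n H) → List (Fin (n H)) → Set
ValidFrom H p F []       = ⊤
ValidFrom H p F (u ∷ us) = u ∉ F × ValidFrom H p (spread H p F ∪ ⁅ u ⁆) us

FinalFrom : (H : Hypergraph) → ℚ → Subset (n H) → List (Fin (n H)) → Subset (n H)
FinalFrom H p F []       = F
FinalFrom H p F (u ∷ us) = FinalFrom H p (spread H p F ∪ ⁅ u ⁆) us

IsBurningSequence : (H : Hypergraph) → ℚ → List (Fin (n H)) → Set
IsBurningSequence H p []       = AllBurned {n H} ⊥
IsBurningSequence H p (u ∷ us) =
  ValidFrom H p ⁅ u ⁆ us × AllBurned (FinalFrom H p ⁅ u ⁆ us)

BurningNumber : Hypergraph → ℚ → ℕ → Set
BurningNumber H p j =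
  (∃ λ us → IsBurningSequence H p us × length us ≡ j) ×
  (∀ us → IsBurningSequence H p us → j ℕ.≤ length us)

iterate : ∀ {A : Set} → (A → A) → ℕ → A → A
iterate f zero    x = x
iterate f (suc t) x = f (iterate f t x)

IsLazyBurningSet : (H : Hypergraph) → ℚ → Subset (n H) → Set
IsLazyBurningSet H p S = ∃ λ t → AllBurned (iterate (spread H p) t S)

LazyBurningNumber : Hypergraph → ℚ → ℕ → Set
LazyBurningNumber H p j =
  (∃ λ S → IsLazyBurningSet H p S × ∣ S ∣ ≡ j) ×
  (∀ S → IsLazyBurningSet H p S → j ℕ.≤ ∣ S ∣)

InUnit : ℚ → Set
InUnit p = 0ℚ ℚ.< p × p ℚ.< 1ℚ

module Submission where

-- For p ∈ (0,1) every edge of a k-uniform hypergraph has the same threshold c = ⌈pk⌉ ∈ {1,…,k},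
-- and c = m+1 exactly when p ∈ (m/k, (m+1)/k]; so b_p and b_{L,p} depend on p only through c.
-- At c = k an edge catches fire only when it is already burned, so both numbers equal n.
-- Lowering the threshold never costs more (a strategy for c' is simulated under c ≤ c'), and
-- lowering it strictly saves a vertex: as soon as some edge holds c+1 burned vertices, one of
-- them, w, could have been left out, because under threshold c that edge re-ignites w.  If this
-- never happens the game for c' never spreads, and an edge e with a vertex x ∉ e lets the game
-- for c finish in n-1 rounds.  So the values at c = 1,…,k strictly increase up to n.

open import Defs

module Ceiling where

  open import Data.Nat as ℕ using (ℕ; zero; suc; NonZero)
  import Data.Nat.Properties as ℕP
  import Data.Nat.Coprimality as ℕC
  open import Data.Integer
    using (ℤ; _+_; +_; 0ℤ; +[1+_]; -[1+_]; 1ℤ; -_; _-_; _/ℕ_; _*_; _≤_; _<_; +<+)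
    renaming (suc to sucℤ)
  import Data.Integer.Properties as ℤP
  open import Data.Integer.DivMod using ([n/ℕd]*d≤n; n<s[n/ℕd]*d; div-pos-is-/ℕ)
  open import Data.Integer.Tactic.RingSolver using (solve-∀)
  open import Data.Rational as ℚ using (ℚ; mkℚ; _/_; ↥_; ↧_; ↧ₙ_; 0ℚ; 1ℚ)
  import Data.Rational.Properties as ℚP
  import Data.Rational.Unnormalised as ℚᵘ
  import Data.Rational.Unnormalised.Properties as ℚᵘP
  open import Data.Product using (∃; _×_; _,_; proj₁; proj₂; swap)
  open import Data.Product.Function.NonDependent.Propositional using (_×-⇔_)
  open import Function.Bundles using (_⇔_; mk⇔; Equivalence)
  open import Function.Properties.Equivalence using () renaming (trans to ⇔-trans; sym to ⇔-sym)
  open import Relation.Binary.PropositionalEquality using (_≡_; refl; sym; trans; cong; subst; subst₂)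

  -- The threshold ⌈pk⌉ of an edge with k vertices.  Opaque, so that unification never
  -- normalises the gcd computations hidden in the rational k / 1.
  opaque
    ⌈_·_⌉ : ℚ → ℕ → ℤ
    ⌈ p · k ⌉ = ℚ.ceiling (p ℚ.* (+ k / 1))

  opaque
    unfolding ⌈_·_⌉

    threshold≡⌈·⌉ : ∀ p k → ℚ.ceiling (p ℚ.* (+ k / 1)) ≡ ⌈ p · k ⌉
    threshold≡⌈·⌉ p k = refl

  toℚᵘ-/ : ∀ i d-1 → ℚ.toℚᵘ (i / suc d-1) ℚᵘ.≃ ℚᵘ.mkℚᵘ i d-1
  toℚᵘ-/ i d-1 = ℚP.toℚᵘ-fromℚᵘ (ℚᵘ.mkℚᵘ i d-1)

  /<⇔ : ∀ i d j e .{{_ : NonZero d}} .{{_ : NonZero e}} → (i / d ℚ.< j / e) ⇔ (i * + e < j * + d)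
  /<⇔ i (suc d) j (suc e) = mk⇔
    (λ lt → ℚᵘP.drop-*<* (ℚᵘP.<-respˡ-≃ (toℚᵘ-/ i d) (ℚᵘP.<-respʳ-≃ (toℚᵘ-/ j e) (ℚP.toℚᵘ-mono-< lt))))
    (λ lt → ℚP.toℚᵘ-cancel-< (ℚᵘP.<-respˡ-≃ (ℚᵘP.≃-sym (toℚᵘ-/ i d))
                                (ℚᵘP.<-respʳ-≃ (ℚᵘP.≃-sym (toℚᵘ-/ j e)) (ℚᵘ.*<* lt))))

  /≤⇔ : ∀ i d j e .{{_ : NonZero d}} .{{_ : NonZero e}} → (i / d ℚ.≤ j / e) ⇔ (i * + e ≤ j * + d)
  /≤⇔ i (suc d) j (suc e) = mk⇔
    (λ le → ℚᵘP.drop-*≤* (ℚᵘP.≤-respˡ-≃ (toℚᵘ-/ i d) (ℚᵘP.≤-respʳ-≃ (toℚᵘ-/ j e) (ℚP.toℚᵘ-mono-≤ le))))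
    (λ le → ℚP.toℚᵘ-cancel-≤ (ℚᵘP.≤-respˡ-≃ (ℚᵘP.≃-sym (toℚᵘ-/ i d))
                                (ℚᵘP.≤-respʳ-≃ (ℚᵘP.≃-sym (toℚᵘ-/ j e)) (ℚᵘ.*≤* le))))

  /ℕ≡⇔ : ∀ a d .{{_ : NonZero d}} q → a /ℕ d ≡ q ⇔ (q * + d ≤ a × a < sucℤ q * + d)
  /ℕ≡⇔ a d@(suc _) q = mk⇔ (λ { refl → [n/ℕd]*d≤n a d , n<s[n/ℕd]*d a d }) λ (q*d≤a , a<[1+q]*d) →
    ℤP.≤-antisym (below (ℤP.≤-<-trans ([n/ℕd]*d≤n a d) a<[1+q]*d))
                 (below (ℤP.≤-<-trans q*d≤a (n<s[n/ℕd]*d a d)))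
    where
    below : ∀ {i j} → i * + d < sucℤ j * + d → i ≤ j
    below {i} {j} lt = subst (i ≤_) (ℤP.pred-suc j) (ℤP.i<j⇒i≤pred[j] (ℤP.*-cancelʳ-<-nonNeg {i} {sucℤ j} (+ d) lt))

  ceiling≡-/ℕ : ∀ q → ℚ.ceiling q ≡ - ((- ↥ q) /ℕ ↧ₙ q)
  ceiling≡-/ℕ (mkℚ -[1+ i ] d-1 _) = cong -_ (div-pos-is-/ℕ +[1+ i ] (suc d-1))
  ceiling≡-/ℕ (mkℚ (+ zero) d-1 _) = cong -_ (div-pos-is-/ℕ (+ 0) (suc d-1))
  ceiling≡-/ℕ (mkℚ +[1+ i ] d-1 _) = cong -_ (div-pos-is-/ℕ -[1+ i ] (suc d-1))

  ceiling≡⇔↥↧ : ∀ q z → ℚ.ceiling q ≡ z ⇔ ((z - 1ℤ) * ↧ q < ↥ q × ↥ q ≤ z * ↧ q)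
  ceiling≡⇔↥↧ q z =
    ⇔-trans floor-of-negation (⇔-trans (/ℕ≡⇔ (- ↥ q) (↧ₙ q) (- z)) (⇔-trans (lower ×-⇔ upper) (mk⇔ swap swap)))
    where
    floor-of-negation : ℚ.ceiling q ≡ z ⇔ (- ↥ q) /ℕ ↧ₙ q ≡ - z
    floor-of-negation = mk⇔
      (λ eq → trans (sym (ℤP.neg-involutive _)) (cong -_ (trans (sym (ceiling≡-/ℕ q)) eq)))
      (λ eq → trans (ceiling≡-/ℕ q) (trans (cong -_ eq) (ℤP.neg-involutive z)))
    lower : (- z) * ↧ q ≤ - ↥ q ⇔ ↥ q ≤ z * ↧ q
    lower = subst (λ x → x ≤ - ↥ q ⇔ ↥ q ≤ z * ↧ q) (ℤP.neg-distribˡ-* z (↧ q))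
                  (mk⇔ ℤP.neg-cancel-≤ ℤP.neg-mono-≤)
    upper : - ↥ q < sucℤ (- z) * ↧ q ⇔ (z - 1ℤ) * ↧ q < ↥ q
    upper = subst (λ x → - ↥ q < x ⇔ (z - 1ℤ) * ↧ q < ↥ q) (shift z (↧ q))
                  (mk⇔ ℤP.neg-cancel-< ℤP.neg-mono-<)
      where
      shift : ∀ z d → - ((z - 1ℤ) * d) ≡ (1ℤ + - z) * d
      shift = solve-∀

  CeilingInterval : ℤ → ℚ → Set
  CeilingInterval z q = (z - 1ℤ) / 1 ℚ.< q × q ℚ.≤ z / 1

  CeilingInterval-/⇔ : ∀ z i d .{{_ : NonZero d}} →
                       CeilingInterval z (i / d) ⇔ ((z - 1ℤ) * + d < i × i ≤ z * + d)
  CeilingInterval-/⇔ z i d =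
    subst (λ x → CeilingInterval z (i / d) ⇔ ((z - 1ℤ) * + d < x × x ≤ z * + d)) (ℤP.*-identityʳ i)
          (/<⇔ (z - 1ℤ) 1 i d ×-⇔ /≤⇔ i d z 1)

  ceiling≡⇔ : ∀ q z → ℚ.ceiling q ≡ z ⇔ CeilingInterval z q
  ceiling≡⇔ q z = ⇔-trans (ceiling≡⇔↥↧ q z)
    (⇔-sym (subst (λ r → CeilingInterval z r ⇔ ((z - 1ℤ) * ↧ q < ↥ q × ↥ q ≤ z * ↧ q))
                  (ℚP.↥p/↧p≡p q) (CeilingInterval-/⇔ z (↥ q) (↧ₙ q))))

  *k/1≡ : ∀ p k → p ℚ.* (+ k / 1) ≡ (↥ p * + k) / ↧ₙ p
  *k/1≡ p@(mkℚ _ d-1 _) k = trans (cong (p ℚ.*_) k/1≡) (ℚP./-cong {↥ p * + k} refl (ℕP.*-identityʳ (suc d-1)))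
    where
    k/1≡ : + k / 1 ≡ mkℚ (+ k) 0 (ℕC.sym (ℕC.1-coprimeTo k))
    k/1≡ = ℚP.↥p/↧p≡p (mkℚ (+ k) 0 (ℕC.sym (ℕC.1-coprimeTo k)))

  ⌈·⌉≡⇔ : ∀ p k z → ⌈ p · k ⌉ ≡ z ⇔ ((z - 1ℤ) * ↧ p < ↥ p * + k × ↥ p * + k ≤ z * ↧ p)
  ⌈·⌉≡⇔ p k z =
    ⇔-trans (subst (λ x → x ≡ z ⇔ CeilingInterval z (p ℚ.* (+ k / 1))) (threshold≡⌈·⌉ p k)
                   (ceiling≡⇔ (p ℚ.* (+ k / 1)) z))
            (subst (λ r → CeilingInterval z r ⇔ ((z - 1ℤ) * ↧ p < ↥ p * + k × ↥ p * + k ≤ z * ↧ p))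
                   (sym (*k/1≡ p k)) (CeilingInterval-/⇔ z (↥ p * + k) (↧ₙ p)))

  ⌈·⌉≡1+⇔ : ∀ p k .{{_ : NonZero k}} m → ⌈ p · k ⌉ ≡ + suc m ⇔ (+ m / k ℚ.< p × p ℚ.≤ + suc m / k)
  ⌈·⌉≡1+⇔ p k m = ⇔-trans (⌈·⌉≡⇔ p k (+ suc m))
    (⇔-sym (subst (λ r → (+ m / k ℚ.< r × r ℚ.≤ + suc m / k) ⇔
                         (+ m * ↧ p < ↥ p * + k × ↥ p * + k ≤ + suc m * ↧ p))
                  (ℚP.↥p/↧p≡p p) (/<⇔ (+ m) k (↥ p) (↧ₙ p) ×-⇔ /≤⇔ (↥ p) (↧ₙ p) (+ suc m) k)))

  0<p⇒0<↥p : ∀ {p} → 0ℚ ℚ.< p → 0ℤ < ↥ p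
  0<p⇒0<↥p {p} 0<p = subst (0ℤ <_) (ℤP.*-identityʳ (↥ p))
    (Equivalence.to (/<⇔ 0ℤ 1 (↥ p) (↧ₙ p)) (subst (0ℚ ℚ.<_) (sym (ℚP.↥p/↧p≡p p)) 0<p))

  p<1⇒↥p<↧p : ∀ {p} → p ℚ.< 1ℚ → ↥ p < ↧ p
  p<1⇒↥p<↧p {p} p<1 = subst₂ _<_ (ℤP.*-identityʳ (↥ p)) (ℤP.*-identityˡ (↧ p))
    (Equivalence.to (/<⇔ (↥ p) (↧ₙ p) 1ℤ 1) (subst (ℚ._< 1ℚ) (sym (ℚP.↥p/↧p≡p p)) p<1))

  p<1⇒p≤k/k : ∀ {p} k .{{_ : NonZero k}} → p ℚ.< 1ℚ → p ℚ.≤ + k / k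
  p<1⇒p≤k/k {p} k p<1 = subst (ℚ._≤ + k / k) (ℚP.↥p/↧p≡p p) (Equivalence.from (/≤⇔ (↥ p) (↧ₙ p) (+ k) k)
    (subst (↥ p * + k ≤_) (ℤP.*-comm (↧ p) (+ k)) (ℤP.*-monoʳ-≤-nonNeg (+ k) (ℤP.<⇒≤ (p<1⇒↥p<↧p p<1)))))

  0<i≤k⇒i≡1+ : ∀ {i k} → 0ℤ < i → i ≤ + k → ∃ λ m → m ℕ.< k × i ≡ + suc m
  0<i≤k⇒i≡1+ {+[1+ m ]} _ i≤k = m , ℤP.drop‿+≤+ i≤k , refl
  0<i≤k⇒i≡1+ {+ zero} (+<+ ()) _

  ⌈·⌉-range : ∀ p k .{{_ : NonZero k}} → 0ℚ ℚ.< p → p ℚ.< 1ℚ → ∃ λ m → m ℕ.< k × ⌈ p · k ⌉ ≡ + suc m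
  ⌈·⌉-range p k@(suc _) 0<p p<1 = 0<i≤k⇒i≡1+ 0<z z≤k
    where
    z = ⌈ p · k ⌉
    bounds : (z - 1ℤ) * ↧ p < ↥ p * + k × ↥ p * + k ≤ z * ↧ p
    bounds = Equivalence.to (⌈·⌉≡⇔ p k z) refl
    0<z : 0ℤ < z
    0<z = ℤP.*-cancelʳ-<-nonNeg (↧ p) (ℤP.<-≤-trans (ℤP.*-monoʳ-<-pos (+ k) (0<p⇒0<↥p 0<p)) (proj₂ bounds))
    z≤k : z ≤ + k
    z≤k = subst (_≤ + k) (1+[z-1]≡z z) (ℤP.i<j⇒suc[i]≤j (ℤP.*-cancelʳ-<-nonNeg {z - 1ℤ} (↧ p)
            (ℤP.<-trans (proj₁ bounds) (subst (↥ p * + k <_) (ℤP.*-comm (↧ p) (+ k))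
               (ℤP.*-monoʳ-<-pos (+ k) (p<1⇒↥p<↧p p<1))))))
      where
      1+[z-1]≡z : ∀ z → 1ℤ + (z - 1ℤ) ≡ z
      1+[z-1]≡z = solve-∀

  ⌈1+m/k·k⌉ : ∀ k .{{_ : NonZero k}} m → ⌈ (+ suc m / k) · k ⌉ ≡ + suc m
  ⌈1+m/k·k⌉ k@(suc _) m = Equivalence.from (⌈·⌉≡1+⇔ (+ suc m / k) k m)
    (Equivalence.from (/<⇔ (+ m) k (+ suc m) k) (ℤP.*-monoʳ-<-pos (+ k) {+ m} (+<+ ℕP.≤-refl)) , ℚP.≤-refl)

open Ceiling using (⌈_·_⌉; threshold≡⌈·⌉; ⌈·⌉≡1+⇔; ⌈·⌉-range; ⌈1+m/k·k⌉; p<1⇒p≤k/k)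

open import Data.Bool using (Bool; true; false; if_then_else_; T)
open import Data.Empty using (⊥-elim)
open import Data.Fin using (Fin; zero; suc)
open import Data.Fin.Properties using (any?; all?) renaming (_≟_ to _≟ᶠ_)
open import Data.Fin.Subset using (Subset; _∈_; _∉_; _⊆_; _⊂_; _∪_; _∩_; _-_; ⁅_⁆; ∣_∣; ⊥; ⊤; Nonempty; inside; outside)
open import Data.Fin.Subset.Properties
  using (_∈?_; x∈p∪q⁺; x∈p∪q⁻; x∈p∩q⁺; x∈p∩q⁻; x∈⁅x⁆; x∈⁅y⁆⇒x≡y; x∈p∧x≢y⇒x∈p-y; x∈p⇒∣p-x∣<∣p∣;
         p⊆q⇒∣p∣≤∣q∣; p⊂q⇒∣p∣<∣q∣; ∣p∣≤n; ∣⊤∣≡n; ∣⊥∣≡0; ∪-identityʳ; ∪-identityˡ; nonempty?; Empty-unique;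
         ⊆-antisym; ⊥⊆; ⊆⊤; ∉⊥; ∈⊤; p⊆p∪q; ∣p∩q∣≤∣q∣; anySubset?)
open import Data.Integer as ℤ using (+_)
import Data.Integer.Properties as ℤP
open import Data.List using (List; []; _∷_; foldr; length)
open import Data.List.Membership.Propositional using (find; lose) renaming (_∈_ to _∈ₗ_)
open import Data.List.Relation.Unary.Any using (here; there)
import Data.List.Relation.Unary.Any as Any
open import Data.List.Relation.Unary.All using (lookup)
open import Data.Nat as ℕ using (ℕ; NonZero; zero; suc; _≤_; _<_; _+_; _∸_; z≤n; s≤s; _<?_; _≟_)
open import Data.Nat.Properties
  using (≤-refl; ≤-trans; ≤-reflexive; <-≤-trans; ≤-<-trans; ≤-antisym; <-irrefl; <-cmp; n≤1+n; ≮⇒≥; <⇒≢; <⇒≤;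
         ≤⇒≯; <⇒≱; 1+n≰n; n≮0; ≤-pred; m≤m+n; m≤n+m; +-suc; +-comm; +-identityʳ; +-monoˡ-≤; +-monoˡ-<;
         suc-injective; m≤n⇒m<n∨m≡n)
open import Data.Product using (Σ; ∃; _×_; _,_; proj₁; proj₂)
open import Data.Rational as ℚ using (ℚ; _/_)
open import Data.Sum using (_⊎_; inj₁; inj₂; [_,_]′; map₂)
open import Data.Unit using (tt)
open import Data.Vec using (_∷_)
open import Function using (_∘_; id)
open import Function.Bundles using (_⇔_; mk⇔; Equivalence)
open import Function.Properties.Equivalence using () renaming (trans to ⇔-trans)
open import Relation.Binary.Definitions using (tri<; tri≈; tri>)
open import Relation.Binary.PropositionalEquality using (_≡_; _≢_; refl; sym; trans; cong; subst)
open import Relation.Nullary using (¬_; Dec; yes; no; ¬?; _×-dec_)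
open import Relation.Nullary.Decidable using (toSum; map′; ⌊_⌋; toWitness; fromWitness; decidable-stable)

Min : {A : Set} → (A → Set) → (A → ℕ) → ℕ → Set
Min P size j = (∃ λ a → P a × size a ≡ j) × (∀ a → P a → j ≤ size a)

Min-unique : ∀ {A : Set} {P : A → Set} {size : A → ℕ} {i j} → Min P size i → Min P size j → i ≡ j
Min-unique ((a , Pa , refl) , i≤) ((b , Pb , refl) , j≤) = ≤-antisym (i≤ b Pb) (j≤ a Pa)

module _ {A : Set} {P Q : A → Set} {size : A → ℕ} where

  Min-≤ : (∀ a → Q a → ∃ λ b → P b × size b ≤ size a) → ∀ {i j} → Min P size i → Min Q size j → i ≤ j
  Min-≤ cheaper (_ , i≤) ((a , Qa , refl) , _) = let (b , Pb , b≤a) = cheaper a Qa in ≤-trans (i≤ b Pb) b≤a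

  Min-< : (∀ a → Q a → ∃ λ b → P b × size b < size a) → ∀ {i j} → Min P size i → Min Q size j → i < j
  Min-< cheaper (_ , i≤) ((a , Qa , refl) , _) = let (b , Pb , b<a) = cheaper a Qa in ≤-<-trans (i≤ b Pb) b<a

least-or-absent : ∀ {Q : ℕ → Set} → (∀ j → Dec (Q j)) → ∀ b →
                  (∃ λ j → Q j × ∀ i → Q i → j ≤ i) ⊎ (∀ i → i < b → ¬ Q i)
least-or-absent Q? zero = inj₂ λ _ ()
least-or-absent Q? (suc b) with least-or-absent Q? b | Q? b
... | inj₁ least  | _      = inj₁ least
... | inj₂ absent | yes Qb = inj₁ (b , Qb , λ i Qi → ≮⇒≥ λ i<b → absent i i<b Qi)
... | inj₂ absent | no ¬Qb = inj₂ λ i i<1+b → [ absent i , (λ { refl → ¬Qb }) ]′ (m≤n⇒m<n∨m≡n (ℕ.s≤s⁻¹ i<1+b))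

Min-exists : ∀ {A : Set} {P : A → Set} {size : A → ℕ} → (∀ j → Dec (∃ λ a → P a × size a ≡ j)) →
             ∀ a → P a → ∃ (Min P size)
Min-exists {size = size} P? a Pa with least-or-absent P? (suc (size a))
... | inj₁ (j , witness , least) = j , witness , λ b Pb → least (size b) (b , Pb , refl)
... | inj₂ absent = ⊥-elim (absent (size a) ≤-refl (a , Pa , refl))

∣p∪⁅x⁆∣≤1+∣p∣ : ∀ {m} (p : Subset m) x → ∣ p ∪ ⁅ x ⁆ ∣ ≤ suc ∣ p ∣
∣p∪⁅x⁆∣≤1+∣p∣ (inside ∷ p) zero = s≤s (≤-trans (≤-reflexive (cong ∣_∣ (∪-identityʳ p))) (n≤1+n ∣ p ∣))
∣p∪⁅x⁆∣≤1+∣p∣ (outside ∷ p) zero = s≤s (≤-reflexive (cong ∣_∣ (∪-identityʳ p)))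
∣p∪⁅x⁆∣≤1+∣p∣ (inside ∷ p) (suc x) = s≤s (∣p∪⁅x⁆∣≤1+∣p∣ p x)
∣p∪⁅x⁆∣≤1+∣p∣ (outside ∷ p) (suc x) = ∣p∪⁅x⁆∣≤1+∣p∣ p x

module _ {m : ℕ} where

  p⊆q∪⁅x⁆⇒∣p∣≤1+∣q∣ : ∀ {p q : Subset m} {x} → p ⊆ q ∪ ⁅ x ⁆ → ∣ p ∣ ≤ suc ∣ q ∣
  p⊆q∪⁅x⁆⇒∣p∣≤1+∣q∣ {q = q} {x} p⊆q∪x = ≤-trans (p⊆q⇒∣p∣≤∣q∣ p⊆q∪x) (∣p∪⁅x⁆∣≤1+∣p∣ q x)

  p-x⊆q⇒p⊆q∪⁅x⁆ : ∀ {p q : Subset m} {x} → p - x ⊆ q → p ⊆ q ∪ ⁅ x ⁆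
  p-x⊆q⇒p⊆q∪⁅x⁆ {x = x} p-x⊆q {y} y∈p with y ≟ᶠ x
  ... | yes refl = x∈p∪q⁺ (inj₂ (x∈⁅x⁆ x))
  ... | no y≢x = x∈p∪q⁺ (inj₁ (p-x⊆q (x∈p∧x≢y⇒x∈p-y y∈p y≢x)))

  p∪⁅x⁆⊆q : ∀ {p q : Subset m} {x} → p ⊆ q → x ∈ q → p ∪ ⁅ x ⁆ ⊆ q
  p∪⁅x⁆⊆q {p} {x = x} p⊆q x∈q y∈ with x∈p∪q⁻ p ⁅ x ⁆ y∈
  ... | inj₁ y∈p = p⊆q y∈p
  ... | inj₂ y∈⁅x⁆ = subst (_∈ _) (sym (x∈⁅y⁆⇒x≡y x y∈⁅x⁆)) x∈q

  ∣p∪⁅x⁆∣≤1+∣q∣ : ∀ {p q : Subset m} {x} → p ⊆ q → ∣ p ∪ ⁅ x ⁆ ∣ ≤ suc ∣ q ∣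
  ∣p∪⁅x⁆∣≤1+∣q∣ {x = x} p⊆q = p⊆q∪⁅x⁆⇒∣p∣≤1+∣q∣ (p∪⁅x⁆⊆q (p⊆p∪q _ ∘ p⊆q) (x∈p∪q⁺ (inj₂ (x∈⁅x⁆ x))))

  ∩-monoʳ : ∀ (e : Subset m) {X Y} → X ⊆ Y → e ∩ X ⊆ e ∩ Y
  ∩-monoʳ e {X} X⊆Y y∈ = let (y∈e , y∈X) = x∈p∩q⁻ e X y∈ in x∈p∩q⁺ (y∈e , X⊆Y y∈X)

  ∣e∩X∣≤1+∣e∩G∣ : ∀ (e : Subset m) {X G w} → X - w ⊆ G → ∣ e ∩ X ∣ ≤ suc ∣ e ∩ G ∣
  ∣e∩X∣≤1+∣e∩G∣ e {X} {G} {w} X-w⊆G = p⊆q∪⁅x⁆⇒∣p∣≤1+∣q∣ λ {y} y∈ →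
    let (y∈e , y∈X) = x∈p∩q⁻ e X y∈ in
    [ (λ y∈G → x∈p∪q⁺ (inj₁ (x∈p∩q⁺ (y∈e , y∈G)))) , (λ y∈⁅w⁆ → x∈p∪q⁺ (inj₂ y∈⁅w⁆)) ]′
    (x∈p∪q⁻ G ⁅ w ⁆ (p-x⊆q⇒p⊆q∪⁅x⁆ X-w⊆G y∈X))

  ∣p∣≤∣p∩q∣⇒p⊆q : ∀ {p q : Subset m} → ∣ p ∣ ≤ ∣ p ∩ q ∣ → p ⊆ q
  ∣p∣≤∣p∩q∣⇒p⊆q {p} {q} ∣p∣≤ {y} y∈p with y ∈? q
  ... | yes y∈q = y∈q
  ... | no y∉q = ⊥-elim (<-irrefl refl (≤-<-trans ∣p∣≤ (p⊂q⇒∣p∣<∣q∣ p∩q⊂p)))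
    where
    p∩q⊂p : p ∩ q ⊂ p
    p∩q⊂p = proj₁ ∘ x∈p∩q⁻ p q , y , y∈p , y∉q ∘ proj₂ ∘ x∈p∩q⁻ p q

  0<∣p∣⇒Nonempty : ∀ {p : Subset m} → 0 < ∣ p ∣ → Nonempty p
  0<∣p∣⇒Nonempty {p} 0<∣p∣ with nonempty? p
  ... | yes ne = ne
  ... | no empty = ⊥-elim (<⇒≢ 0<∣p∣ (sym (trans (cong ∣_∣ (Empty-unique empty)) (∣⊥∣≡0 m))))

  c<∣p∩q∣⇒common : ∀ {c} {p q : Subset m} → c < ∣ p ∩ q ∣ → ∃ λ x → x ∈ p × x ∈ q
  c<∣p∩q∣⇒common {p = p} {q} c< = let (x , x∈p∩q) = 0<∣p∣⇒Nonempty (≤-<-trans z≤n c<) in x , x∈p∩q⁻ p q x∈p∩q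

  AllBurned⇒n≤∣F∣ : ∀ {F : Subset m} → AllBurned F → m ≤ ∣ F ∣
  AllBurned⇒n≤∣F∣ {F} all = subst (_≤ ∣ F ∣) (∣⊤∣≡n m) (p⊆q⇒∣p∣≤∣q∣ {p = ⊤} (λ {v} _ → all v))

module _ {m : ℕ} (fires : Subset m → Bool) where

  unionFiring : Subset m → List (Subset m) → Subset m
  unionFiring F = foldr (λ e acc → if fires e then e ∪ acc else acc) F

  ⊆-unionFiring : ∀ F E → F ⊆ unionFiring F E
  ⊆-unionFiring F [] = id
  ⊆-unionFiring F (e ∷ E) with fires e
  ... | true = x∈p∪q⁺ ∘ inj₂ ∘ ⊆-unionFiring F E
  ... | false = ⊆-unionFiring F E

  edge⊆unionFiring : ∀ F {E e} → e ∈ₗ E → T (fires e) → e ⊆ unionFiring F E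
  edge⊆unionFiring F {e ∷ E} (here refl) fired with fires e
  ... | true = x∈p∪q⁺ ∘ inj₁
  edge⊆unionFiring F {e' ∷ E} (there e∈E) fired with fires e'
  ... | true = x∈p∪q⁺ ∘ inj₂ ∘ edge⊆unionFiring F e∈E fired
  ... | false = edge⊆unionFiring F e∈E fired

  private
    there′ : ∀ {E e' v} → (∃ λ e → e ∈ₗ E × T (fires e) × v ∈ e) → ∃ λ e → e ∈ₗ e' ∷ E × T (fires e) × v ∈ e
    there′ (e , e∈E , fired , v∈e) = e , there e∈E , fired , v∈e

  ∈-unionFiring⁻ : ∀ F E {v} → v ∈ unionFiring F E → v ∈ F ⊎ ∃ λ e → e ∈ₗ E × T (fires e) × v ∈ e
  ∈-unionFiring⁻ F [] v∈F = inj₁ v∈F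
  ∈-unionFiring⁻ F (e ∷ E) v∈ with fires e in fired
  ... | false = map₂ there′ (∈-unionFiring⁻ F E v∈)
  ... | true with x∈p∪q⁻ e (unionFiring F E) v∈
  ...   | inj₁ v∈e = inj₂ (e , here refl , subst T (sym fired) _ , v∈e)
  ...   | inj₂ v∈rest = map₂ there′ (∈-unionFiring⁻ F E v∈rest)

-- A record rather than a function type, so that H, p and c are inferred from it without
-- unifying through spread.  For the same reason the case splits below that involve spread use
-- [_,_]′ instead of with, whose abstraction would normalise the rational thresholds in spread.
record HasThreshold (H : Hypergraph) (p : ℚ) (c : ℕ) : Set where
  field threshold≡ : ∀ {e} → e ∈ₗ edges H → threshold p e ≡ + c
open HasThreshold

⊆-spread : ∀ H p {F} → F ⊆ spread H p F
⊆-spread H p {F} = ⊆-unionFiring _ F (edges H)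

edge-exceeding? : ∀ H c X → (∃ λ e → e ∈ₗ edges H × c < ∣ e ∩ X ∣) ⊎ (∀ {e} → e ∈ₗ edges H → ∣ e ∩ X ∣ ≤ c)
edge-exceeding? H c X with Any.any? (λ e → c <? ∣ e ∩ X ∣) (edges H)
... | yes some = inj₁ (find some)
... | no none = inj₂ λ e∈ → ≮⇒≥ λ c< → none (lose e∈ c<)

full-exceeds : ∀ {H k c X e} → Uniform k H → c < k → AllBurned X → e ∈ₗ edges H → c < ∣ e ∩ X ∣
full-exceeds {X = X} {e} uniform c<k full e∈ =
  <-≤-trans c<k (subst (_≤ ∣ e ∩ X ∣) (lookup uniform e∈) (p⊆q⇒∣p∣≤∣q∣ {p = e} λ y∈e → x∈p∩q⁺ (y∈e , full _)))

module _ {H : Hypergraph} {p : ℚ} {c : ℕ} (thr : HasThreshold H p c) where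

  ∈-spread⁻ : ∀ {F v} → v ∈ spread H p F → v ∈ F ⊎ ∃ λ e → e ∈ₗ edges H × c ≤ ∣ e ∩ F ∣ × v ∈ e
  ∈-spread⁻ {F} v∈ = map₂ fires⇒ (∈-unionFiring⁻ _ F (edges H) v∈)
    where
    fires⇒ : ∀ {v} → (∃ λ e → e ∈ₗ edges H × T ⌊ threshold p e ℤ.≤? + ∣ e ∩ F ∣ ⌋ × v ∈ e) →
             ∃ λ e → e ∈ₗ edges H × c ≤ ∣ e ∩ F ∣ × v ∈ e
    fires⇒ (e , e∈ , fired , v∈e) = e , e∈ , ℤP.drop‿+≤+ (subst (ℤ._≤ _) (threshold≡ thr e∈) (toWitness fired)) , v∈e

  edge⊆spread : ∀ {F e} → e ∈ₗ edges H → c ≤ ∣ e ∩ F ∣ → e ⊆ spread H p F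
  edge⊆spread {F} e∈ c≤ = edge⊆unionFiring _ F e∈ (fromWitness (subst (ℤ._≤ _) (sym (threshold≡ thr e∈)) (ℤ.+≤+ c≤)))

  spread-quiet : ∀ {X} → (∀ {e} → e ∈ₗ edges H → ∣ e ∩ X ∣ < c) → spread H p X ⊆ X
  spread-quiet quiet v∈ = [ id , (λ (e , e∈ , c≤ , _) → ⊥-elim (<⇒≱ (quiet e∈) c≤)) ]′ (∈-spread⁻ v∈)

  spread-at-top : Uniform c H → ∀ {X} → spread H p X ⊆ X
  spread-at-top uniform v∈ =
    [ id , (λ (e , e∈ , c≤ , v∈e) → ∣p∣≤∣p∩q∣⇒p⊆q (subst (_≤ _) (sym (lookup uniform e∈)) c≤) v∈e) ]′ (∈-spread⁻ v∈)

  spread-⊥ : 0 < c → spread H p ⊥ ≡ ⊥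
  spread-⊥ 0<c = ⊆-antisym (spread-quiet λ {e} _ → ≤-<-trans (∣p∩q∣≤∣q∣ e ⊥) (subst (_< c) (sym (∣⊥∣≡0 (n H))) 0<c)) ⊥⊆

module _ {H : Hypergraph} {p p' : ℚ} {c c' : ℕ} (thr : HasThreshold H p c) (thr' : HasThreshold H p' c') where

  spread-mono : c ≤ c' → ∀ {X Y} → X ⊆ Y → spread H p' X ⊆ spread H p Y
  spread-mono c≤c' {X} X⊆Y v∈ = [ ⊆-spread H p ∘ X⊆Y , fired ]′ (∈-spread⁻ thr' v∈)
    where
    fired : ∀ {v} → (∃ λ e → e ∈ₗ edges H × c' ≤ ∣ e ∩ X ∣ × v ∈ e) → v ∈ spread H p _
    fired (e , e∈ , c'≤ , v∈e) = edge⊆spread thr e∈ (≤-trans c≤c' (≤-trans c'≤ (p⊆q⇒∣p∣≤∣q∣ (∩-monoʳ e X⊆Y)))) v∈e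

  -- Every edge loses at most the vertex w, so what fires from X under c' fires from G under c;
  -- w itself is re-ignited by the edge e.
  spread-skip : c < c' → ∀ {X G w e} → X - w ⊆ G → e ∈ₗ edges H → w ∈ e → c < ∣ e ∩ X ∣ →
                spread H p' X ⊆ spread H p G
  spread-skip c<c' {X} {G} {w} {e} X-w⊆G e∈ w∈e c<∣e∩X∣ v∈ = [ kept , fired ]′ (∈-spread⁻ thr' v∈)
    where
    fires-from-G : ∀ f → c < ∣ f ∩ X ∣ → c ≤ ∣ f ∩ G ∣
    fires-from-G f c<∣f∩X∣ = ≤-pred (≤-trans c<∣f∩X∣ (∣e∩X∣≤1+∣e∩G∣ f X-w⊆G))
    kept : ∀ {v} → v ∈ X → v ∈ spread H p G
    kept {v} v∈X =
      [ (λ v≡w → subst (_∈ spread H p G) (sym v≡w) (edge⊆spread thr e∈ (fires-from-G e c<∣e∩X∣) w∈e))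
      , (λ v≢w → ⊆-spread H p (X-w⊆G (x∈p∧x≢y⇒x∈p-y v∈X v≢w))) ]′ (toSum (v ≟ᶠ w))
    fired : ∀ {v} → (∃ λ f → f ∈ₗ edges H × c' ≤ ∣ f ∩ X ∣ × v ∈ f) → v ∈ spread H p G
    fired (f , f∈ , c'≤ , v∈f) = edge⊆spread thr f∈ (fires-from-G f (<-≤-trans c<c' c'≤)) v∈f

module _ {m : ℕ} (s : Subset m → Subset m) (monotone : ∀ {X Y} → X ⊆ Y → s X ⊆ s Y) where

  iterate-⊆-closed : ∀ {S} → s S ⊆ S → ∀ t → iterate s t S ⊆ S
  iterate-⊆-closed closed zero = id
  iterate-⊆-closed closed (suc t) = closed ∘ monotone (iterate-⊆-closed closed t)

  module _ (inflationary : ∀ {X} → X ⊆ s X) where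

    ⊆-iterate : ∀ {S} t → S ⊆ iterate s t S
    ⊆-iterate zero = id
    ⊆-iterate (suc t) = inflationary ∘ ⊆-iterate t

    iterate-stalls : ∀ {S} i → iterate s (suc i) S ⊆ iterate s i S → ∀ t → iterate s t S ⊆ iterate s i S
    iterate-stalls i stalled zero = ⊆-iterate i
    iterate-stalls i stalled (suc t) = stalled ∘ monotone (iterate-stalls i stalled t)

    stalls-or-grows : ∀ S i → (∀ t → iterate s t S ⊆ iterate s i S) ⊎ i ≤ ∣ iterate s i S ∣
    stalls-or-grows S zero = inj₂ z≤n
    stalls-or-grows S (suc i) with stalls-or-grows S i
    ... | inj₁ stalled = inj₁ λ t → inflationary ∘ stalled t
    ... | inj₂ i≤∣Xᵢ∣ with any? (λ y → (y ∈? iterate s (suc i) S) ×-dec ¬? (y ∈? iterate s i S))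
    ...   | yes (y , y∈Xᵢ₊₁ , y∉Xᵢ) = inj₂ (≤-trans (s≤s i≤∣Xᵢ∣) (p⊂q⇒∣p∣<∣q∣ (inflationary , y , y∈Xᵢ₊₁ , y∉Xᵢ)))
    ...   | no no-new = inj₁ λ t → inflationary ∘ iterate-stalls i
              (λ {y} y∈ → decidable-stable (y ∈? iterate s i S) λ y∉ → no-new (y , y∈ , y∉)) t

    iterate-saturates : ∀ S t → iterate s t S ⊆ iterate s (suc m) S
    iterate-saturates S t with stalls-or-grows S (suc m)
    ... | inj₁ stalled = stalled t
    ... | inj₂ 1+m≤ = ⊥-elim (1+n≰n (≤-trans 1+m≤ (∣p∣≤n (iterate s (suc m) S))))

iterate-dominated : ∀ {m} (s s' : Subset m → Subset m) → (∀ {X Y} → X ⊆ Y → s' X ⊆ s Y) →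
                    ∀ {S G} d → S ⊆ iterate s d G → ∀ t → iterate s' t S ⊆ iterate s (t + d) G
iterate-dominated s s' dominated d S⊆ zero = S⊆
iterate-dominated s s' dominated d S⊆ (suc t) = dominated (iterate-dominated s s' dominated d S⊆ t)

module _ {H : Hypergraph} {p : ℚ} {c : ℕ} (thr : HasThreshold H p c) where

  lazy-burning? : ∀ S → Dec (IsLazyBurningSet H p S)
  lazy-burning? S = map′ (suc (n H) ,_)
    (λ (t , full) v → iterate-saturates (spread H p) (spread-mono thr thr ≤-refl) (⊆-spread H p) S t (full v))
    (all? λ v → v ∈? iterate (spread H p) (suc (n H)) S)

  lazy-optimum : ∃ (Min (IsLazyBurningSet H p) ∣_∣)
  lazy-optimum = Min-exists (λ j → anySubset? λ S → lazy-burning? S ×-dec (∣ S ∣ ≟ j)) ⊤ (0 , λ _ → ∈⊤)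

  lazy-at-top : Uniform c H → Min (IsLazyBurningSet H p) ∣_∣ (n H)
  lazy-at-top uniform = (⊤ , (0 , λ _ → ∈⊤) , ∣⊤∣≡n (n H)) , λ _ (t , full) →
    AllBurned⇒n≤∣F∣ λ v →
      iterate-⊆-closed (spread H p) (spread-mono thr thr ≤-refl) (spread-at-top thr uniform) t (full v)

module _ {H : Hypergraph} {p p' : ℚ} {c c' : ℕ} (thr : HasThreshold H p c) (thr' : HasThreshold H p' c') where

  lazy-cheaper : c ≤ c' → ∀ S → IsLazyBurningSet H p' S → ∃ λ S' → IsLazyBurningSet H p S' × ∣ S' ∣ ≤ ∣ S ∣
  lazy-cheaper c≤c' S (t , full) =
    S , (t + 0 , λ v → iterate-dominated (spread H p) (spread H p') (spread-mono thr thr' c≤c') 0 id t (full v)) ,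
    ≤-refl

  lazy-strictly-cheaper : ∀ {k e₀} → Uniform k H → c < c' → c' ≤ k → e₀ ∈ₗ edges H →
                          ∀ S → IsLazyBurningSet H p' S → ∃ λ S' → IsLazyBurningSet H p S' × ∣ S' ∣ < ∣ S ∣
  lazy-strictly-cheaper uniform c<c' c'≤k e₀∈ S (t , full) = [ exceeded , ⊥-elim ∘ not-quiet ]′ (edge-exceeding? H c S)
    where
    not-quiet : ¬ (∀ {e} → e ∈ₗ edges H → ∣ e ∩ S ∣ ≤ c)
    not-quiet quiet = ≤⇒≯ (quiet e₀∈) (full-exceeds uniform (<-≤-trans c<c' c'≤k) S-full e₀∈)
      where
      S-full : AllBurned S
      S-full v = iterate-⊆-closed (spread H p') (spread-mono thr' thr' ≤-refl)
                   (spread-quiet thr' λ e∈ → ≤-<-trans (quiet e∈) c<c') t (full v)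
    exceeded : (∃ λ e → e ∈ₗ edges H × c < ∣ e ∩ S ∣) → ∃ λ S' → IsLazyBurningSet H p S' × ∣ S' ∣ < ∣ S ∣
    exceeded (e , e∈ , c<∣e∩S∣) = let (w , w∈e , w∈S) = c<∣p∩q∣⇒common c<∣e∩S∣ in
      S - w , (t + 1 , λ v → iterate-dominated (spread H p) (spread H p') (spread-mono thr thr' (<⇒≤ c<c')) 1
                               (λ v∈S → spread-skip thr thr' c<c' {S} {S - w} {w} {e} id e∈ w∈e c<∣e∩S∣
                                          (⊆-spread H p' v∈S))
                               t (full v)) ,
      x∈p⇒∣p-x∣<∣p∣ w∈S

BurnsFrom : (H : Hypergraph) → ℚ → Subset (n H) → List (Fin (n H)) → Set
BurnsFrom H p F us = ValidFrom H p F us × AllBurned (FinalFrom H p F us)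

BurnableWithin : (H : Hypergraph) → ℚ → Subset (n H) → ℕ → Set
BurnableWithin H p F L = ∃ λ us → BurnsFrom H p F us × length us ≤ L

BurnableBefore : (H : Hypergraph) → ℚ → Subset (n H) → ℕ → Set
BurnableBefore H p F L = ∃ λ us → BurnsFrom H p F us × length us < L

module _ {H : Hypergraph} {p : ℚ} where

  burnable-full : ∀ {F L} → AllBurned F → BurnableWithin H p F L
  burnable-full full = [] , (tt , full) , z≤n

  within-mono : ∀ {F L L'} → L ≤ L' → BurnableWithin H p F L → BurnableWithin H p F L'
  within-mono L≤L' (us , burns , len) = us , burns , ≤-trans len L≤L'

  within⇒before : ∀ {F L L'} → L < L' → BurnableWithin H p F L → BurnableBefore H p F L'
  within⇒before L<L' (us , burns , len) = us , burns , ≤-<-trans len L<L'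

  before-mono : ∀ {F L L'} → L ≤ L' → BurnableBefore H p F L → BurnableBefore H p F L'
  before-mono L≤L' (us , burns , len) = us , burns , <-≤-trans len L≤L'

  ignite : ∀ {F} v {L} → v ∉ F → BurnableWithin H p (spread H p F ∪ ⁅ v ⁆) L → BurnableWithin H p F (suc L)
  ignite v v∉F (us , (valid , full) , len) = v ∷ us , ((v∉F , valid) , full) , s≤s len

  one-round : ∀ {F} w {L} → (∀ {G} → spread H p F ⊆ G → w ∈ G → BurnableWithin H p G L) →
              BurnableWithin H p F (suc L)
  one-round {F} w {L} next = [ w-burned , (λ w∉F → ignite w w∉F (next′ (x∈p∪q⁺ (inj₂ (x∈⁅x⁆ w))))) ]′ (toSum (w ∈? F))
    where
    next′ : ∀ {v} → w ∈ spread H p F ∪ ⁅ v ⁆ → BurnableWithin H p (spread H p F ∪ ⁅ v ⁆) L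
    next′ {v} = next (p⊆p∪q ⁅ v ⁆)
    w-burned : w ∈ F → BurnableWithin H p F (suc L)
    w-burned w∈F = [ (λ (v , v∉F) → ignite v v∉F (next′ (x∈p∪q⁺ (inj₁ (⊆-spread H p w∈F)))))
                   , (λ none → burnable-full λ v → decidable-stable (v ∈? F) λ v∉F → none (v , v∉F)) ]′
                   (toSum (any? λ v → ¬? (v ∈? F)))

  cover : ∀ b {F} T {L} → ∣ T ∣ ≤ b → (∀ {G} → F ⊆ G → T ⊆ G → BurnableWithin H p G L) →
          BurnableWithin H p F (b + L)
  cover zero T ∣T∣≤0 next = next id λ t∈T → ⊥-elim (n≮0 (≤-trans (x∈p⇒∣p-x∣<∣p∣ t∈T) ∣T∣≤0))
  cover (suc b) {F} T {L} ∣T∣≤1+b next with nonempty? T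
  ... | no empty = within-mono (m≤n+m L (suc b)) (next id λ t∈T → ⊥-elim (empty (_ , t∈T)))
  ... | yes (t , t∈T) = one-round t λ sF⊆G t∈G →
    cover b (T - t) (≤-pred (<-≤-trans (x∈p⇒∣p-x∣<∣p∣ t∈T) ∣T∣≤1+b)) λ G⊆G' T-t⊆G' →
      next (G⊆G' ∘ sF⊆G ∘ ⊆-spread H p) (p∪⁅x⁆⊆q T-t⊆G' (G⊆G' t∈G) ∘ p-x⊆q⇒p⊆q∪⁅x⁆ id)

  burnable-within-n : ∀ F → BurnableWithin H p F (n H)
  burnable-within-n F = within-mono (≤-reflexive (+-identityʳ (n H)))
    (cover (n H) ⊤ (∣p∣≤n ⊤) λ _ ⊤⊆G → burnable-full λ v → ⊤⊆G ∈⊤)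

  burnable-exactly? : ∀ j F → Dec (∃ λ us → BurnsFrom H p F us × length us ≡ j)
  burnable-exactly? zero F = map′ (λ full → [] , (tt , full) , refl) from (all? (_∈? F))
    where
    from : (∃ λ us → BurnsFrom H p F us × length us ≡ 0) → AllBurned F
    from ([] , (_ , full) , _) = full
  burnable-exactly? (suc j) F = map′ to from (any? λ u → ¬? (u ∈? F) ×-dec burnable-exactly? j (spread H p F ∪ ⁅ u ⁆))
    where
    Opening : Fin (n H) → Set
    Opening u = u ∉ F × ∃ λ us → BurnsFrom H p (spread H p F ∪ ⁅ u ⁆) us × length us ≡ j
    to : (∃ λ u → Opening u) → ∃ λ us → BurnsFrom H p F us × length us ≡ suc j
    to (u , u∉F , us , (valid , full) , len) = u ∷ us , ((u∉F , valid) , full) , cong suc len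
    from : (∃ λ us → BurnsFrom H p F us × length us ≡ suc j) → ∃ λ u → Opening u
    from (u ∷ us , ((u∉F , valid) , full) , len) = u , u∉F , us , (valid , full) , suc-injective len

  burning-lower-bound : (∀ {X} → spread H p X ⊆ X) → ∀ {F} us → BurnsFrom H p F us → n H ≤ ∣ F ∣ + length us
  burning-lower-bound closed {F} [] (_ , full) = ≤-trans (AllBurned⇒n≤∣F∣ full) (m≤m+n ∣ F ∣ 0)
  burning-lower-bound closed {F} (_ ∷ us) ((_ , valid) , full) =
    ≤-trans (burning-lower-bound closed us (valid , full))
            (≤-trans (+-monoˡ-≤ (length us) (∣p∪⁅x⁆∣≤1+∣q∣ closed)) (≤-reflexive (sym (+-suc ∣ F ∣ (length us)))))

  burning-sequence⇔ : ∀ {c} → HasThreshold H p (suc c) → ∀ us → IsBurningSequence H p us ⇔ BurnsFrom H p ⊥ us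
  burning-sequence⇔ thr [] = mk⇔ (tt ,_) proj₂
  burning-sequence⇔ thr (u ∷ us) = mk⇔
    (λ burns → let (valid , full) = subst (λ X → BurnsFrom H p X us) (sym first-round) burns in (∉⊥ , valid) , full)
    (λ ((_ , valid) , full) → subst (λ X → BurnsFrom H p X us) first-round (valid , full))
    where
    first-round : spread H p ⊥ ∪ ⁅ u ⁆ ≡ ⁅ u ⁆
    first-round = trans (cong (_∪ ⁅ u ⁆) (spread-⊥ thr (s≤s z≤n))) (∪-identityˡ ⁅ u ⁆)

module _ {H : Hypergraph} {p p' : ℚ} {c c' : ℕ} (thr : HasThreshold H p c) (thr' : HasThreshold H p' c')
         (c≤c' : c ≤ c') where

  simulate : ∀ us {F G} → F ⊆ G → BurnsFrom H p' F us → BurnableWithin H p G (length us)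
  simulate-round : ∀ u us {F G} → spread H p' F ⊆ spread H p G → BurnsFrom H p' (spread H p' F ∪ ⁅ u ⁆) us →
                   BurnableWithin H p G (suc (length us))

  simulate [] F⊆G (_ , full) = burnable-full (F⊆G ∘ full)
  simulate (u ∷ us) F⊆G ((_ , valid) , full) = simulate-round u us (spread-mono thr thr' c≤c' F⊆G) (valid , full)

  simulate-round u us {F} {G} sF⊆sG burns = one-round u λ {G'} sG⊆G' u∈G' →
    simulate us (p∪⁅x⁆⊆q {p = spread H p' F} {G'} (λ v∈ → sG⊆G' (sF⊆sG v∈)) u∈G') burns

module _ {H : Hypergraph} {p : ℚ} {c k : ℕ} (thr : HasThreshold H p c) (uniform : Uniform k H) (c<k : c < k) where

  -- Burn everything except a vertex w of e and a vertex x outside e, then place x: e re-ignites w.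
  burnable-before-n : ∀ {e x} → e ∈ₗ edges H → x ∉ e → ∀ F → BurnableBefore H p F (n H)
  burnable-before-n {e} {x} e∈ x∉e F =
    around (0<∣p∣⇒Nonempty (subst (0 <_) (sym (lookup uniform e∈)) (≤-<-trans z≤n c<k)))
    where
    around : Nonempty e → BurnableBefore H p F (n H)
    around (w , w∈e) =
      within⇒before (subst (_< n H) (+-comm 1 ∣ Others ∣) two-fewer) (cover ∣ Others ∣ Others ≤-refl finish)
      where
      Others : Subset (n H)
      Others = ⊤ - w - x
      x≢w : x ≢ w
      x≢w x≡w = x∉e (subst (_∈ e) (sym x≡w) w∈e)
      two-fewer : suc (suc ∣ Others ∣) ≤ n H
      two-fewer = ≤-trans (s≤s (x∈p⇒∣p-x∣<∣p∣ (x∈p∧x≢y⇒x∈p-y ∈⊤ x≢w)))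
                          (subst (suc ∣ ⊤ - w ∣ ≤_) (∣⊤∣≡n (n H)) (x∈p⇒∣p-x∣<∣p∣ {x = w} {p = ⊤} ∈⊤))
      finish : ∀ {G} → F ⊆ G → Others ⊆ G → BurnableWithin H p G 1
      finish {G} _ Others⊆G = one-round x λ sG⊆G' x∈G' → burnable-full (everything sG⊆G' x∈G')
        where
        Others∋ : ∀ {v} → v ≢ w → v ≢ x → v ∈ G
        Others∋ v≢w v≢x = Others⊆G (x∈p∧x≢y⇒x∈p-y (x∈p∧x≢y⇒x∈p-y ∈⊤ v≢w) v≢x)
        e⊆ : e ⊆ (e ∩ G) ∪ ⁅ w ⁆
        e⊆ {v} v∈e = [ (λ v≡w → x∈p∪q⁺ (inj₂ (subst (_∈ ⁅ w ⁆) (sym v≡w) (x∈⁅x⁆ w))))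
                     , (λ v≢w → x∈p∪q⁺ (inj₁ (x∈p∩q⁺ (v∈e , Others∋ v≢w λ v≡x → x∉e (subst (_∈ e) v≡x v∈e))))) ]′
                     (toSum (v ≟ᶠ w))
        e-fires : c ≤ ∣ e ∩ G ∣
        e-fires = ≤-pred (≤-trans c<k (subst (_≤ suc ∣ e ∩ G ∣) (lookup uniform e∈) (p⊆q∪⁅x⁆⇒∣p∣≤1+∣q∣ e⊆)))
        everything : ∀ {G'} → spread H p G ⊆ G' → x ∈ G' → AllBurned G'
        everything {G'} sG⊆G' x∈G' v = [ (λ v≡x → subst (_∈ G') (sym v≡x) x∈G') , not-x ]′ (toSum (v ≟ᶠ x))
          where
          not-x : v ≢ x → v ∈ G'
          not-x v≢x = [ (λ v≡w → sG⊆G' (subst (_∈ spread H p G) (sym v≡w) (edge⊆spread thr e∈ e-fires w∈e)))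
                      , (λ v≢w → sG⊆G' (⊆-spread H p (Others∋ v≢w v≢x))) ]′ (toSum (v ≟ᶠ w))

module _ {H : Hypergraph} {p p' : ℚ} {c c' k : ℕ} (thr : HasThreshold H p c) (thr' : HasThreshold H p' c')
         (c<c' : c < c') (uniform : Uniform k H) (c'≤k : c' ≤ k) {e₀ x₀} (e₀∈ : e₀ ∈ₗ edges H) (x₀∉e₀ : x₀ ∉ e₀) where

  -- r counts the rounds already played: while no edge holds more than c burned vertices nothing
  -- spreads under c', so each round adds at most one vertex to X.
  strictly-cheaper-from : ∀ us {X} r → ∣ X ∣ ≤ r → BurnsFrom H p' X us → BurnableBefore H p ⊥ (r + length us)
  strictly-cheaper-from [] r ∣X∣≤r (_ , full) =
    before-mono (≤-trans (AllBurned⇒n≤∣F∣ full) (≤-trans ∣X∣≤r (m≤m+n r 0)))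
                (burnable-before-n thr uniform (<-≤-trans c<c' c'≤k) e₀∈ x₀∉e₀ ⊥)
  strictly-cheaper-from (u ∷ us) {X} r ∣X∣≤r ((_ , valid) , full) = [ exceeded , quiet ]′ (edge-exceeding? H c X)
    where
    exceeded : (∃ λ e → e ∈ₗ edges H × c < ∣ e ∩ X ∣) → BurnableBefore H p ⊥ (r + suc (length us))
    exceeded (e , e∈ , c<∣e∩X∣) = let (w , w∈e , w∈X) = c<∣p∩q∣⇒common c<∣e∩X∣ in
      within⇒before (+-monoˡ-< (suc (length us)) (<-≤-trans (x∈p⇒∣p-x∣<∣p∣ w∈X) ∣X∣≤r))
        (cover ∣ X - w ∣ (X - w) ≤-refl λ {G} _ X-w⊆G →
          simulate-round thr thr' (<⇒≤ c<c') u us (spread-skip thr thr' c<c' {X} {G} {w} {e} X-w⊆G e∈ w∈e c<∣e∩X∣)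
                         (valid , full))
    quiet : (∀ {e} → e ∈ₗ edges H → ∣ e ∩ X ∣ ≤ c) → BurnableBefore H p ⊥ (r + suc (length us))
    quiet quiet = subst (BurnableBefore H p ⊥) (sym (+-suc r (length us)))
      (strictly-cheaper-from us (suc r) (≤-trans (∣p∪⁅x⁆∣≤1+∣q∣ idle) (s≤s ∣X∣≤r)) (valid , full))
      where
      idle : spread H p' X ⊆ X
      idle = spread-quiet thr' λ e∈ → ≤-<-trans (quiet e∈) c<c'

module _ {H : Hypergraph} {p : ℚ} {c : ℕ} (thr : HasThreshold H p (suc c)) where

  burning-optimum : ∃ (Min (IsBurningSequence H p) length)
  burning-optimum = let (us , burns , _) = burnable-within-n ⊥ in
    Min-exists exactly? us (Equivalence.from (burning-sequence⇔ thr us) burns)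
    where
    exactly? : ∀ j → Dec (∃ λ us → IsBurningSequence H p us × length us ≡ j)
    exactly? j = map′ (λ (us , burns , len) → us , Equivalence.from (burning-sequence⇔ thr us) burns , len)
                      (λ (us , burns , len) → us , Equivalence.to (burning-sequence⇔ thr us) burns , len)
                      (burnable-exactly? j ⊥)

  burning-at-top : Uniform (suc c) H → Min (IsBurningSequence H p) length (n H)
  burning-at-top uniform = let (us , burns , len≤n) = burnable-within-n ⊥ in
    (us , Equivalence.from (burning-sequence⇔ thr us) burns , ≤-antisym len≤n (at-least us burns)) ,
    λ us' b' → at-least us' (Equivalence.to (burning-sequence⇔ thr us') b')
    where
    at-least : ∀ us → BurnsFrom H p ⊥ us → n H ≤ length us
    at-least us burns =
      subst (λ z → n H ≤ z + length us) (∣⊥∣≡0 (n H)) (burning-lower-bound (spread-at-top thr uniform) us burns)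

module _ {H : Hypergraph} {p p' : ℚ} {c c' : ℕ}
         (thr : HasThreshold H p (suc c)) (thr' : HasThreshold H p' (suc c')) where

  burning-cheaper : c ≤ c' → ∀ us → IsBurningSequence H p' us →
                    ∃ λ us' → IsBurningSequence H p us' × length us' ≤ length us
  burning-cheaper c≤c' us b =
    let (us' , burns , len) = simulate thr thr' (s≤s c≤c') us id (Equivalence.to (burning-sequence⇔ thr' us) b)
    in us' , Equivalence.from (burning-sequence⇔ thr us') burns , len

  burning-strictly-cheaper : ∀ {k e₀ x₀} → c < c' → Uniform k H → suc c' ≤ k → e₀ ∈ₗ edges H → x₀ ∉ e₀ →
                             ∀ us → IsBurningSequence H p' us →
                             ∃ λ us' → IsBurningSequence H p us' × length us' < length us
  burning-strictly-cheaper c<c' uniform c'<k e₀∈ x₀∉e₀ us b =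
    let (us' , burns , len) = strictly-cheaper-from thr thr' (s≤s c<c') uniform c'<k e₀∈ x₀∉e₀ us 0
                                (≤-reflexive (∣⊥∣≡0 (n H))) (Equivalence.to (burning-sequence⇔ thr' us) b)
    in us' , Equivalence.from (burning-sequence⇔ thr us') burns , len

module ThresholdProfile
  (k-1 : ℕ) (N : ℕ) {A : Set} (P : ℚ → A → Set) (size : A → ℕ)
  (optimum : ∀ {p m} → ⌈ p · suc k-1 ⌉ ≡ + suc m → ∃ (Min (P p) size))
  (cheaper : ∀ {p p' m m'} → ⌈ p · suc k-1 ⌉ ≡ + suc m → ⌈ p' · suc k-1 ⌉ ≡ + suc m' → m ≤ m' →
             ∀ a → P p' a → ∃ λ b → P p b × size b ≤ size a)
  (strictly-cheaper : ∀ {p p' m m'} → ⌈ p · suc k-1 ⌉ ≡ + suc m → ⌈ p' · suc k-1 ⌉ ≡ + suc m' → m < m' → m' ≤ k-1 →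
                      ∀ a → P p' a → ∃ λ b → P p b × size b < size a)
  (optimum-at-top : ∀ {p} → ⌈ p · suc k-1 ⌉ ≡ + suc k-1 → Min (P p) size N)
  where

  private
    k : ℕ
    k = suc k-1

  Value : ℚ → ℕ → Set
  Value p = Min (P p) size

  same-ceiling⇒same-value : ∀ {p q m r} → ⌈ p · k ⌉ ≡ + suc m → ⌈ q · k ⌉ ≡ + suc m → Value q r → Value p r
  same-ceiling⇒same-value ⌈p⌉ ⌈q⌉ vq = let (_ , vp) = optimum ⌈p⌉ in
    subst (Value _) (≤-antisym (Min-≤ (cheaper ⌈p⌉ ⌈q⌉ ≤-refl) vp vq) (Min-≤ (cheaper ⌈q⌉ ⌈p⌉ ≤-refl) vq vp)) vp

  same-value⇒same-ceiling : ∀ {p q r m m'} → Value p r → Value q r → ⌈ p · k ⌉ ≡ + suc m' → ⌈ q · k ⌉ ≡ + suc m →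
                            m' ≤ k-1 → m ≤ k-1 → m' ≡ m
  same-value⇒same-ceiling {m = m} {m'} vp vq ⌈p⌉ ⌈q⌉ m'≤k-1 m≤k-1 with <-cmp m' m
  ... | tri< m'<m _ _ = ⊥-elim (<-irrefl refl (Min-< (strictly-cheaper ⌈p⌉ ⌈q⌉ m'<m m≤k-1) vp vq))
  ... | tri≈ _ m'≡m _ = m'≡m
  ... | tri> _ _ m<m' = ⊥-elim (<-irrefl refl (Min-< (strictly-cheaper ⌈q⌉ ⌈p⌉ m<m' m'≤k-1) vq vp))

  level : ∀ {q r m} → Value q r → ⌈ q · k ⌉ ≡ + suc m → m ≤ k-1 →
          ∀ p → InUnit p → Value p r ⇔ (+ m / k ℚ.< p × p ℚ.≤ + suc m / k)
  level {q} {r} {m} vq ⌈q⌉ m≤k-1 p (0<p , p<1) =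
    ⇔-trans (mk⇔ to λ ⌈p⌉ → same-ceiling⇒same-value ⌈p⌉ ⌈q⌉ vq) (⌈·⌉≡1+⇔ p k m)
    where
    to : Value p r → ⌈ p · k ⌉ ≡ + suc m
    to vp = let (m' , m'<k , ⌈p⌉) = ⌈·⌉-range p k 0<p p<1 in
      subst (λ i → ⌈ p · k ⌉ ≡ + suc i) (same-value⇒same-ceiling vp vq ⌈p⌉ ⌈q⌉ (ℕ.s≤s⁻¹ m'<k) m≤k-1) ⌈p⌉

  private
    ⌈k/k·k⌉ : ⌈ (+ k / k) · k ⌉ ≡ + k
    ⌈k/k·k⌉ = ⌈1+m/k·k⌉ k k-1

  top-level : ∀ p → InUnit p → Value p N ⇔ (+ (k ∸ 1) / k) ℚ.< p
  top-level p p∈ = ⇔-trans (level (optimum-at-top ⌈k/k·k⌉) ⌈k/k·k⌉ ≤-refl p p∈)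
                           (mk⇔ proj₁ (λ k-1/k<p → k-1/k<p , p<1⇒p≤k/k k (proj₂ p∈)))

  lower-levels : ∀ m → suc m < k →
                 Σ ℕ λ r → r < N × (∀ p → InUnit p → Value p r ⇔ (+ m / k ℚ.< p × p ℚ.≤ + suc m / k))
  lower-levels m 1+m<k = let (r , vr) = optimum (⌈1+m/k·k⌉ k m) in
    r , Min-< (strictly-cheaper (⌈1+m/k·k⌉ k m) ⌈k/k·k⌉ (ℕ.s≤s⁻¹ 1+m<k) ≤-refl) vr (optimum-at-top ⌈k/k·k⌉) ,
    level vr (⌈1+m/k·k⌉ k m) (<⇒≤ (ℕ.s≤s⁻¹ 1+m<k))

  only-levels : ∀ j → j ≢ N → (∃ λ p → InUnit p × Value p j) →
                Σ ℕ λ m → suc m < k × (∀ p → InUnit p → Value p j ⇔ (+ m / k ℚ.< p × p ℚ.≤ + suc m / k))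
  only-levels j j≢N (p , (0<p , p<1) , vp) = from-level (⌈·⌉-range p k 0<p p<1)
    where
    Goal : Set
    Goal = Σ ℕ λ m → suc m < k × (∀ p → InUnit p → Value p j ⇔ (+ m / k ℚ.< p × p ℚ.≤ + suc m / k))
    from-level : (∃ λ m → m < k × ⌈ p · k ⌉ ≡ + suc m) → Goal
    from-level (m , m<k , ⌈p⌉) = [ below-top , (λ m≡k-1 → ⊥-elim (j≢N (at-top m≡k-1))) ]′ (m≤n⇒m<n∨m≡n (ℕ.s≤s⁻¹ m<k))
      where
      below-top : m < k-1 → Goal
      below-top m<k-1 = m , s≤s m<k-1 , level vp ⌈p⌉ (<⇒≤ m<k-1)
      at-top : m ≡ k-1 → j ≡ N
      at-top m≡k-1 = Min-unique vp (optimum-at-top (subst (λ i → ⌈ p · k ⌉ ≡ + suc i) m≡k-1 ⌈p⌉))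

uniform-threshold : ∀ {H k p c} → Uniform k H → ⌈ p · k ⌉ ≡ + c → HasThreshold H p c
uniform-threshold {p = p} uniform ⌈p·k⌉ = record
  { threshold≡ = λ {e} e∈ → trans (threshold≡⌈·⌉ p ∣ e ∣) (trans (cong ⌈ p ·_⌉ (lookup uniform e∈)) ⌈p·k⌉) }

edge-missing-a-vertex : ∀ {H} → MultipleDistinctEdges H → ∃ λ e → e ∈ₗ edges H × ∃ λ x → x ∉ e
edge-missing-a-vertex (e₁ , e₂ , e₁∈ , e₂∈ , e₁≢e₂) with any? (λ x → ¬? (x ∈? e₁)) | any? (λ x → ¬? (x ∈? e₂))
... | yes (x , x∉e₁) | _ = e₁ , e₁∈ , x , x∉e₁
... | no _ | yes (x , x∉e₂) = e₂ , e₂∈ , x , x∉e₂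
... | no e₁-full | no e₂-full = ⊥-elim (e₁≢e₂ (trans (≡⊤ e₁-full) (sym (≡⊤ e₂-full))))
  where
  ≡⊤ : ∀ {e : Subset _} → ¬ (∃ λ x → x ∉ e) → e ≡ ⊤
  ≡⊤ {e} e-full = ⊆-antisym ⊆⊤ λ {x} _ → decidable-stable (x ∈? e) λ x∉e → e-full (x , x∉e)

corollary3p9 :
  (H : Hypergraph) (k : ℕ) .{{_ : NonZero k}} →
  Uniform k H → Connected H → MultipleDistinctEdges H →
  -- Q_n = P_n = ((k-1)/k, 1)
  (∀ p → InUnit p →
     (LazyBurningNumber H p (n H) ⇔ (+ (k ∸ 1) / k) ℚ.< p) ×
     (BurningNumber H p (n H) ⇔ (+ (k ∸ 1) / k) ℚ.< p)) ×
  -- each (m/k, (m+1)/k], 0 ≤ m ≤ k-2, is some Q_r and some P_s with r,s < n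
  (∀ m → ℕ.suc m ℕ.< k →
     (Σ ℕ λ r → r ℕ.< n H × (∀ p → InUnit p →
        (LazyBurningNumber H p r ⇔ ((+ m / k) ℚ.< p × p ℚ.≤ (+ (ℕ.suc m) / k))))) ×
     (Σ ℕ λ s → s ℕ.< n H × (∀ p → InUnit p →
        (BurningNumber H p s ⇔ ((+ m / k) ℚ.< p × p ℚ.≤ (+ (ℕ.suc m) / k)))))) ×
  -- every other nonempty Q_j / P_j is of that form
  (∀ j → j ≢ n H → (∃ λ p → InUnit p × LazyBurningNumber H p j) →
     Σ ℕ λ m → ℕ.suc m ℕ.< k × (∀ p → InUnit p →
        (LazyBurningNumber H p j ⇔ ((+ m / k) ℚ.< p × p ℚ.≤ (+ (ℕ.suc m) / k))))) ×
  (∀ j → j ≢ n H → (∃ λ p → InUnit p × BurningNumber H p j) →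
     Σ ℕ λ m → ℕ.suc m ℕ.< k × (∀ p → InUnit p →
        (BurningNumber H p j ⇔ ((+ m / k) ℚ.< p × p ℚ.≤ (+ (ℕ.suc m) / k)))))
corollary3p9 H zero = ⊥-elim (ℕ.≢-nonZero⁻¹ zero refl)
corollary3p9 H (suc k-1) uniform _ distinct-edges =
  (λ p p∈ → Lazy.top-level p p∈ , Burning.top-level p p∈) ,
  (λ m 1+m<k → Lazy.lower-levels m 1+m<k , Burning.lower-levels m 1+m<k) ,
  Lazy.only-levels , Burning.only-levels
  where
  thr : ∀ {p c} → ⌈ p · suc k-1 ⌉ ≡ + c → HasThreshold H p c
  thr = uniform-threshold uniform
  outside-edge : ∃ λ e → e ∈ₗ edges H × ∃ λ x → x ∉ e
  outside-edge = edge-missing-a-vertex distinct-edges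
  module Lazy = ThresholdProfile k-1 (n H) (IsLazyBurningSet H) ∣_∣
    (λ ⌈p⌉ → lazy-optimum (thr ⌈p⌉))
    (λ ⌈p⌉ ⌈p'⌉ m≤m' → lazy-cheaper (thr ⌈p⌉) (thr ⌈p'⌉) (s≤s m≤m'))
    (λ ⌈p⌉ ⌈p'⌉ m<m' m'≤k-1 →
       lazy-strictly-cheaper (thr ⌈p⌉) (thr ⌈p'⌉) uniform (s≤s m<m') (s≤s m'≤k-1) (proj₁ (proj₂ outside-edge)))
    (λ ⌈p⌉ → lazy-at-top (thr ⌈p⌉) uniform)
  module Burning = ThresholdProfile k-1 (n H) (IsBurningSequence H) length
    (λ ⌈p⌉ → burning-optimum (thr ⌈p⌉))
    (λ ⌈p⌉ ⌈p'⌉ → burning-cheaper (thr ⌈p⌉) (thr ⌈p'⌉))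
    (λ ⌈p⌉ ⌈p'⌉ m<m' m'≤k-1 → burning-strictly-cheaper (thr ⌈p⌉) (thr ⌈p'⌉) m<m' uniform (s≤s m'≤k-1)
                                 (proj₁ (proj₂ outside-edge)) (proj₂ (proj₂ (proj₂ outside-edge))))
    (λ ⌈p⌉ → burning-at-top (thr ⌈p⌉) uniform)
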